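{- For every positive integer $k$, with $n = 3^k$, $A_k = \{x \in \{0,1\}^n : \mathrm{RecMaj}_k(x) = 1\}$ and $Z_k = \{0,1\}^n \setminus A_k$, there exists a map $f_k \colon \{0,1\}^n \to A_k$ such that: (1) $f_k(x) = x$ for all $x \in A_k$; (2) for each $x \in A_k$ there is a unique $z \in Z_k$ with $f_k(z) = x$; (3) for every $i \in [n]$, $\mathbb{E}_{x \in \{0,1\}^n}[\mathrm{dist}(f_k(x), f_k(x+e_i))] \le 10$, with $x$ uniform in $\{0,1\}^n$.
   Context: The recursive majority of 3's, $\mathrm{RecMaj}_k \colon \{0,1\}^{3^k} \to \{0,1\}$, is defined by: $\mathrm{RecMaj}_1$ is the majority of its 3 input bits; for $k>1$, writing $x = x^{(1)} \circ x^{(2)} \circ x^{(3)}$ with each $x^{(r)} \in \{0,1\}^{3^{k-1}}$ (consecutive thirds), $\mathrm{RecMaj}_k(x) = \mathrm{Maj}(\mathrm{RecMaj}_{k-1}(x^{(1)}),\mathrm{RecMaj}_{k-1}(x^{(2)}),\mathrm{RecMaj}_{k-1}(x^{(3)}))$. $\mathrm{dist}$ is the Hamming distance, $e_i$ is the $i$-th standard basis vector and addition is modulo 2. -}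

module Defs where

open import Data.Bool using (Bool; true; false; not; _∧_; _∨_; _xor_; if_then_else_)
open import Data.Nat using (ℕ; zero; suc; _+_; _*_; _^_)
open import Data.Vec using (Vec; []; _∷_; take; drop; updateAt)
open import Data.List using (List; []; _∷_; map; _++_)
open import Data.Fin using (Fin)
open import Data.Product using (_,_)

maj : Bool → Bool → Bool → Bool
maj a b c = (a ∧ b) ∨ (a ∧ c) ∨ (b ∧ c)

-- recMaj k = RecMaj_{k+1} : {0,1}^(3^(k+1)) → {0,1}.
-- Note 3 ^ suc m = 3 * 3 ^ m = m' + (m' + (m' + 0)) with m' = 3 ^ m,
-- so splitAt yields the three consecutive thirds.
recMaj : (k : ℕ) → Vec Bool (3 ^ suc k) → Bool
recMaj zero (a ∷ b ∷ c ∷ []) = maj a b c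
recMaj (suc k) x =
  maj (recMaj k (take m x))
      (recMaj k (take m (drop m x)))
      (recMaj k (take m (drop m (drop m x))))
  where m = 3 ^ suc k

dist : {n : ℕ} → Vec Bool n → Vec Bool n → ℕ
dist [] [] = 0
dist (a ∷ x) (b ∷ y) = (if a xor b then 1 else 0) + dist x y

flip : {n : ℕ} → Fin n → Vec Bool n → Vec Bool n
flip i x = updateAt x i not

allVecs : (n : ℕ) → List (Vec Bool n)
allVecs zero = [] ∷ []
allVecs (suc n) = map (false ∷_) (allVecs n) ++ map (true ∷_) (allVecs n)

module Submission where

-- By induction on k we build a retraction g of the cube onto the accepting
-- set A of RecMaj, together with a map h : A → Z inverting g on Z.  The
-- induction carries the record 'GoodRetraction m r': r is balanced, g has
-- average stretch ≤ 10 in every direction i, and for every i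
-- Pr[r changes when bit i flips] · E[dist(y, g y)] ≤ 1.
--
-- The base is the one-bit dictator with g ≡ 1, h ≡ 0 (RecMaj on 3 bits is one
-- step above it).  A step splits x = (u, v, w) into three blocks and repairs a
-- block with g exactly when its cyclic predecessor rejects.  This map commutes
-- with rotating the blocks, so flipping a bit of any block costs as much as
-- flipping a bit of the first; that cost is computed exactly from the old
-- quantities, and two inequalities between natural numbers close the
-- induction.

open import Defs
open import Data.Bool using (Bool; true; false; not; _∧_; _∨_; _xor_; if_then_else_)
open import Data.Bool.Properties using (xor-same; xor-comm; xor-inverseʳ)
open import Data.Fin using (Fin; zero; suc; _↑ˡ_; _↑ʳ_)
open import Data.List using (List; map) renaming (_++_ to _++ₗ_)
open import Data.List.Properties using (map-++; map-∘)
open import Data.Nat using (ℕ; zero; suc; _+_; _*_; _^_; _≤_; z≤n; s≤s)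
open import Data.Nat.ListAction using (sum)
open import Data.Nat.ListAction.Properties using (sum-++)
open import Data.Nat.Properties
open import Algebra.Properties.CommutativeSemigroup +-commutativeSemigroup using (interchange)
open import Data.Nat.Tactic.RingSolver using (solve-∀)
open import Data.Product using (Σ; ∃; _×_; _,_)
open import Data.Vec using (Vec; []; _∷_; _++_; take; drop)
open import Data.Vec.Properties using (take++drop≡id)
open import Relation.Binary.PropositionalEquality

-- The indicator 0/1 of a Boolean; note dist (a ∷ x) (b ∷ y) is
-- definitionally ind (a xor b) + dist x y.
ind : Bool → ℕ
ind b = if b then 1 else 0

ind-+-not : ∀ b → ind b + ind (not b) ≡ 1
ind-+-not true = refl
ind-+-not false = refl

∑ : (n : ℕ) → (Vec Bool n → ℕ) → ℕ
∑ zero φ = φ []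
∑ (suc n) φ = ∑ n (λ x → φ (false ∷ x)) + ∑ n (λ x → φ (true ∷ x))

sum-allVecs : ∀ n (φ : Vec Bool n → ℕ) → sum (map φ (allVecs n)) ≡ ∑ n φ
sum-allVecs zero φ = +-identityʳ (φ [])
sum-allVecs (suc n) φ = begin
    sum (map φ (map (false ∷_) A ++ₗ map (true ∷_) A))
  ≡⟨ cong sum (map-++ φ (map (false ∷_) A) _) ⟩
    sum (map φ (map (false ∷_) A) ++ₗ map φ (map (true ∷_) A))
  ≡⟨ sum-++ (map φ (map (false ∷_) A)) _ ⟩
    sum (map φ (map (false ∷_) A)) + sum (map φ (map (true ∷_) A))
  ≡⟨ cong₂ _+_ (cong sum (sym (map-∘ A))) (cong sum (sym (map-∘ A))) ⟩
    sum (map (λ x → φ (false ∷ x)) A) + sum (map (λ x → φ (true ∷ x)) A)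
  ≡⟨ cong₂ _+_ (sum-allVecs n _) (sum-allVecs n _) ⟩
    ∑ (suc n) φ ∎
  where
    open ≡-Reasoning
    A : List (Vec Bool n)
    A = allVecs n

∑-cong : ∀ n {φ ψ : Vec Bool n → ℕ} → (∀ x → φ x ≡ ψ x) → ∑ n φ ≡ ∑ n ψ
∑-cong zero eq = eq []
∑-cong (suc n) eq = cong₂ _+_ (∑-cong n (λ x → eq (false ∷ x))) (∑-cong n (λ x → eq (true ∷ x)))

∑-+ : ∀ n (φ ψ : Vec Bool n → ℕ) → ∑ n (λ x → φ x + ψ x) ≡ ∑ n φ + ∑ n ψ
∑-+ zero φ ψ = refl
∑-+ (suc n) φ ψ =
  trans (cong₂ _+_ (∑-+ n _ _) (∑-+ n _ _)) (interchange (∑ n (λ x → φ (false ∷ x))) _ _ _)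

∑-*ˡ : ∀ n a (φ : Vec Bool n → ℕ) → ∑ n (λ x → a * φ x) ≡ a * ∑ n φ
∑-*ˡ zero a φ = refl
∑-*ˡ (suc n) a φ = trans (cong₂ _+_ (∑-*ˡ n a _) (∑-*ˡ n a _)) (sym (*-distribˡ-+ a _ _))

∑-*ʳ : ∀ n a (φ : Vec Bool n → ℕ) → ∑ n (λ x → φ x * a) ≡ ∑ n φ * a
∑-*ʳ n a φ = trans (∑-cong n (λ x → *-comm (φ x) a)) (trans (∑-*ˡ n a φ) (*-comm a _))

∑-const : ∀ n a → ∑ n (λ _ → a) ≡ 2 ^ n * a
∑-const zero a = sym (*-identityˡ a)
∑-const (suc n) a = begin
    ∑ n (λ _ → a) + ∑ n (λ _ → a)
  ≡⟨ cong₂ _+_ (∑-const n a) (∑-const n a) ⟩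
    2 ^ n * a + 2 ^ n * a
  ≡⟨ cong (2 ^ n * a +_) (sym (+-identityʳ (2 ^ n * a))) ⟩
    2 * (2 ^ n * a)
  ≡⟨ sym (*-assoc 2 (2 ^ n) a) ⟩
    2 ^ suc n * a ∎
  where open ≡-Reasoning

∑-++ : ∀ m n (φ : Vec Bool (m + n) → ℕ) → ∑ (m + n) φ ≡ ∑ m (λ u → ∑ n (λ v → φ (u ++ v)))
∑-++ zero n φ = refl
∑-++ (suc m) n φ = cong₂ _+_ (∑-++ m n _) (∑-++ m n _)

∑-swap : ∀ m n (f : Vec Bool m → Vec Bool n → ℕ) →
  ∑ m (λ u → ∑ n (λ v → f u v)) ≡ ∑ n (λ v → ∑ m (λ u → f u v))
∑-swap zero n f = refl
∑-swap (suc m) n f = trans (cong₂ _+_ (∑-swap m n _) (∑-swap m n _)) (sym (∑-+ n _ _))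

∑-through : ∀ m (r : Vec Bool m → Bool) (Φ : Bool → ℕ) →
  ∑ m (λ y → Φ (r y)) ≡ Φ true * ∑ m (λ y → ind (r y)) + Φ false * ∑ m (λ y → ind (not (r y)))
∑-through m r Φ = begin
    ∑ m (λ y → Φ (r y))
  ≡⟨ ∑-cong m (λ y → by-cases (r y)) ⟩
    ∑ m (λ y → Φ true * ind (r y) + Φ false * ind (not (r y)))
  ≡⟨ ∑-+ m _ _ ⟩
    ∑ m (λ y → Φ true * ind (r y)) + ∑ m (λ y → Φ false * ind (not (r y)))
  ≡⟨ cong₂ _+_ (∑-*ˡ m (Φ true) _) (∑-*ˡ m (Φ false) _) ⟩
    Φ true * ∑ m (λ y → ind (r y)) + Φ false * ∑ m (λ y → ind (not (r y))) ∎
  where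
    open ≡-Reasoning
    by-cases : ∀ b → Φ b ≡ Φ true * ind b + Φ false * ind (not b)
    by-cases true = sym (trans (cong₂ _+_ (*-identityʳ (Φ true)) (*-zeroʳ (Φ false))) (+-identityʳ _))
    by-cases false = sym (cong₂ _+_ (*-zeroʳ (Φ true)) (*-identityʳ (Φ false)))

accepted+rejected : ∀ m (r : Vec Bool m → Bool) →
  ∑ m (λ y → ind (r y)) + ∑ m (λ y → ind (not (r y))) ≡ 2 ^ m
accepted+rejected m r = begin
    ∑ m (λ y → ind (r y)) + ∑ m (λ y → ind (not (r y)))
  ≡⟨ sym (∑-+ m _ _) ⟩
    ∑ m (λ y → ind (r y) + ind (not (r y)))
  ≡⟨ ∑-cong m (λ y → ind-+-not (r y)) ⟩
    ∑ m (λ _ → 1)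
  ≡⟨ trans (∑-const m 1) (*-identityʳ _) ⟩
    2 ^ m ∎
  where open ≡-Reasoning

dist-refl : ∀ {n} (u : Vec Bool n) → dist u u ≡ 0
dist-refl [] = refl
dist-refl (a ∷ u) = cong₂ _+_ (cong ind (xor-same a)) (dist-refl u)

dist-sym : ∀ {n} (u v : Vec Bool n) → dist u v ≡ dist v u
dist-sym [] [] = refl
dist-sym (a ∷ u) (b ∷ v) = cong₂ _+_ (cong ind (xor-comm a b)) (dist-sym u v)

dist-flip : ∀ {n} (j : Fin n) (u : Vec Bool n) → dist u (flip j u) ≡ 1
dist-flip zero (a ∷ u) = cong₂ _+_ (cong ind (xor-inverseʳ a)) (dist-refl u)
dist-flip (suc j) (a ∷ u) = cong₂ _+_ (cong ind (xor-same a)) (dist-flip j u)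

dist-++ : ∀ {m n} (u u′ : Vec Bool m) (y y′ : Vec Bool n) →
  dist (u ++ y) (u′ ++ y′) ≡ dist u u′ + dist y y′
dist-++ [] [] y y′ = refl
dist-++ (a ∷ u) (b ∷ u′) y y′ =
  trans (cong (ind (a xor b) +_) (dist-++ u u′ y y′)) (sym (+-assoc (ind (a xor b)) _ _))

take-++ : ∀ {A : Set} {m n} (u : Vec A m) (y : Vec A n) → take m (u ++ y) ≡ u
take-++ [] y = refl
take-++ (a ∷ u) y = cong (a ∷_) (take-++ u y)

drop-++ : ∀ {A : Set} {m n} (u : Vec A m) (y : Vec A n) → drop m (u ++ y) ≡ y
drop-++ [] y = refl
drop-++ (a ∷ u) y = drop-++ u y

flip-↑ˡ : ∀ {m n} (j : Fin m) (u : Vec Bool m) (y : Vec Bool n) → flip (j ↑ˡ n) (u ++ y) ≡ flip j u ++ y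
flip-↑ˡ zero (a ∷ u) y = refl
flip-↑ˡ (suc j) (a ∷ u) y = cong (a ∷_) (flip-↑ˡ j u y)

flip-↑ʳ : ∀ {m n} (j : Fin n) (u : Vec Bool m) (y : Vec Bool n) → flip (m ↑ʳ j) (u ++ y) ≡ u ++ flip j y
flip-↑ʳ j [] y = refl
flip-↑ʳ j (a ∷ u) y = cong (a ∷_) (flip-↑ʳ j u y)

data Split (m n : ℕ) : Fin (m + n) → Set where
  left : (j : Fin m) → Split m n (j ↑ˡ n)
  right : (j : Fin n) → Split m n (m ↑ʳ j)

split : ∀ m n (i : Fin (m + n)) → Split m n i
split zero n i = right i
split (suc m) n zero = left zero
split (suc m) n (suc i) with split m n i
... | left j = left (suc j)
... | right j = right j

maj-rot : ∀ a b c → maj a b c ≡ maj b c a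
maj-rot true true true = refl
maj-rot true true false = refl
maj-rot true false true = refl
maj-rot true false false = refl
maj-rot false true true = refl
maj-rot false true false = refl
maj-rot false false true = refl
maj-rot false false false = refl

rotate-maj : ∀ a b c {d} → maj a b c ≡ d → maj b c a ≡ d
rotate-maj a b c = trans (sym (maj-rot a b c))

maj-cong : ∀ {a a′ b b′ c c′} → a ≡ a′ → b ≡ b′ → c ≡ c′ → maj a b c ≡ maj a′ b′ c′
maj-cong refl refl refl = refl

maj-pivotal : ∀ a a′ b c → ind (maj a b c xor maj a′ b c) ≡ ind (a xor a′) * ind (b xor c)
maj-pivotal true true true true = refl
maj-pivotal true true true false = refl
maj-pivotal true true false true = refl
maj-pivotal true true false false = refl
maj-pivotal true false true true = refl
maj-pivotal true false true false = refl
maj-pivotal true false false true = refl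
maj-pivotal true false false false = refl
maj-pivotal false true true true = refl
maj-pivotal false true true false = refl
maj-pivotal false true false true = refl
maj-pivotal false true false false = refl
maj-pivotal false false true true = refl
maj-pivotal false false true false = refl
maj-pivotal false false false true = refl
maj-pivotal false false false false = refl

maj-repaired : ∀ a b c → maj (not c ∨ a) (not a ∨ b) (not b ∨ c) ≡ true
maj-repaired true true true = refl
maj-repaired true true false = refl
maj-repaired true false true = refl
maj-repaired true false false = refl
maj-repaired false true true = refl
maj-repaired false true false = refl
maj-repaired false false true = refl
maj-repaired false false false = refl

maj-predecessor : ∀ a b c → maj a b c ≡ true → (c ∨ a) ≡ true
maj-predecessor true b true _ = refl
maj-predecessor true b false _ = refl
maj-predecessor false true true _ = refl
maj-predecessor false false c ()
maj-predecessor false true false ()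

maj-broken : ∀ a b c → maj a b c ≡ true → maj (a ∧ not b) (b ∧ not c) (c ∧ not a) ≡ false
maj-broken true true true _ = refl
maj-broken true true false _ = refl
maj-broken true false true _ = refl
maj-broken false true true _ = refl
maj-broken true false false ()
maj-broken false true false ()
maj-broken false false true ()
maj-broken false false false ()

module Blocks (m : ℕ) where

  -- L = 3m, written so that it is definitionally 3 ^ suc n when m = 3 ^ n.
  L : ℕ
  L = m + (m + (m + 0))

  mk : Vec Bool m → Vec Bool m → Vec Bool m → Vec Bool L
  mk u v w = u ++ (v ++ (w ++ []))

  -- The blocks exactly as recMaj extracts them.
  block₁ block₂ block₃ : Vec Bool L → Vec Bool m
  block₁ x = take m x
  block₂ x = take m (drop m x)
  block₃ x = take m (drop m (drop m x))

  block₁-mk : ∀ u v w → block₁ (mk u v w) ≡ u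
  block₁-mk u v w = take-++ u _

  block₂-mk : ∀ u v w → block₂ (mk u v w) ≡ v
  block₂-mk u v w = trans (cong (take m) (drop-++ u _)) (take-++ v _)

  block₃-mk : ∀ u v w → block₃ (mk u v w) ≡ w
  block₃-mk u v w =
    trans (cong (take m) (trans (cong (drop m) (drop-++ u _)) (drop-++ v _))) (take-++ w _)

  mk-blocks : ∀ x → mk (block₁ x) (block₂ x) (block₃ x) ≡ x
  mk-blocks x = trans (cong (take m x ++_) middle) (take++drop≡id m x)
    where
      y : Vec Bool (m + (m + 0))
      y = drop m x
      z : Vec Bool (m + 0)
      z = drop m y
      empty : (e : Vec Bool 0) → [] ≡ e
      empty [] = refl
      last : take m z ++ [] ≡ z
      last = trans (cong (take m z ++_) (empty (drop m z))) (take++drop≡id m z)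
      middle : take m y ++ (take m z ++ []) ≡ y
      middle = trans (cong (take m y ++_) last) (take++drop≡id m y)

  mk-cong : ∀ {u u′ v v′ w w′} → u ≡ u′ → v ≡ v′ → w ≡ w′ → mk u v w ≡ mk u′ v′ w′
  mk-cong refl refl refl = refl

  dist-mk : ∀ u v w u′ v′ w′ → dist (mk u v w) (mk u′ v′ w′) ≡ dist u u′ + (dist v v′ + dist w w′)
  dist-mk u v w u′ v′ w′ = trans (dist-++ u u′ _ _) (cong (dist u u′ +_)
    (trans (dist-++ v v′ _ _) (cong (dist v v′ +_) (trans (dist-++ w w′ [] []) (+-identityʳ _)))))

  dist-mk-rot : ∀ u v w u′ v′ w′ → dist (mk u v w) (mk u′ v′ w′) ≡ dist (mk v w u) (mk v′ w′ u′)
  dist-mk-rot u v w u′ v′ w′ = begin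
      dist (mk u v w) (mk u′ v′ w′)
    ≡⟨ dist-mk u v w u′ v′ w′ ⟩
      dist u u′ + (dist v v′ + dist w w′)
    ≡⟨ trans (+-comm (dist u u′) _) (+-assoc (dist v v′) _ _) ⟩
      dist v v′ + (dist w w′ + dist u u′)
    ≡⟨ sym (dist-mk v w u v′ w′ u′) ⟩
      dist (mk v w u) (mk v′ w′ u′) ∎
    where open ≡-Reasoning

  ∑³ : (Vec Bool m → Vec Bool m → Vec Bool m → ℕ) → ℕ
  ∑³ f = ∑ m (λ u → ∑ m (λ v → ∑ m (λ w → f u v w)))

  ∑-blocks : ∀ φ → ∑ L φ ≡ ∑³ (λ u v w → φ (mk u v w))
  ∑-blocks φ = trans (∑-++ m _ φ) (∑-cong m (λ u →
    trans (∑-++ m _ _) (∑-cong m (λ v → ∑-++ m 0 _))))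

  ∑³-cong : ∀ {f f′} → (∀ u v w → f u v w ≡ f′ u v w) → ∑³ f ≡ ∑³ f′
  ∑³-cong eq = ∑-cong m (λ u → ∑-cong m (λ v → ∑-cong m (λ w → eq u v w)))

  ∑³-+ : ∀ f f′ → ∑³ (λ u v w → f u v w + f′ u v w) ≡ ∑³ f + ∑³ f′
  ∑³-+ f f′ = trans (∑-cong m (λ u → trans (∑-cong m (λ v → ∑-+ m _ _)) (∑-+ m _ _))) (∑-+ m _ _)

  ∑³-rot : ∀ f → ∑³ (λ u v w → f v w u) ≡ ∑³ f
  ∑³-rot f = trans (∑-swap m m (λ u v → ∑ m (λ w → f v w u)))
                   (∑-cong m (λ v → ∑-swap m m (λ u w → f v w u)))

  ∑³-rot² : ∀ f → ∑³ (λ u v w → f w u v) ≡ ∑³ f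
  ∑³-rot² f = trans (∑³-rot (λ u v w → f v w u)) (∑³-rot f)

  flip-block₁ : ∀ j u v w → flip (j ↑ˡ (m + (m + 0))) (mk u v w) ≡ mk (flip j u) v w
  flip-block₁ j u v w = flip-↑ˡ j u _

  flip-block₂ : ∀ j u v w → flip (m ↑ʳ (j ↑ˡ (m + 0))) (mk u v w) ≡ mk u (flip j v) w
  flip-block₂ j u v w = trans (flip-↑ʳ _ u _) (cong (u ++_) (flip-↑ˡ j v _))

  flip-block₃ : ∀ j u v w → flip (m ↑ʳ (m ↑ʳ (j ↑ˡ 0))) (mk u v w) ≡ mk u v (flip j w)
  flip-block₃ j u v w =
    trans (flip-↑ʳ _ u _) (cong (u ++_) (trans (flip-↑ʳ _ v _) (cong (v ++_) (flip-↑ˡ j w _))))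

  data Block : Fin L → Set where
    first : (j : Fin m) → Block (j ↑ˡ (m + (m + 0)))
    second : (j : Fin m) → Block (m ↑ʳ (j ↑ˡ (m + 0)))
    third : (j : Fin m) → Block (m ↑ʳ (m ↑ʳ (j ↑ˡ 0)))

  block : (i : Fin L) → Block i
  block i with split m (m + (m + 0)) i
  ... | left j = first j
  ... | right i′ with split m (m + 0) i′
  ...   | left j = second j
  ...   | right i″ with split m 0 i″
  ...     | left j = third j
  ...     | right ()

  RotationInvariant : (Vec Bool L → Vec Bool L → ℕ) → Set
  RotationInvariant Φ = ∀ u v w u′ v′ w′ → Φ (mk u v w) (mk u′ v′ w′) ≡ Φ (mk v w u) (mk v′ w′ u′)

  flip-any-block : ∀ Φ → RotationInvariant Φ → (i : Fin L) →
    ∃ λ j → ∑ L (λ x → Φ x (flip i x)) ≡ ∑³ (λ u v w → Φ (mk u v w) (mk (flip j u) v w))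
  flip-any-block Φ inv i = reduce i (block i)
    where
      first-block : Fin m → Vec Bool m → Vec Bool m → Vec Bool m → ℕ
      first-block j u v w = Φ (mk u v w) (mk (flip j u) v w)

      reduce : ∀ i → Block i → ∃ λ j → ∑ L (λ x → Φ x (flip i x)) ≡ ∑³ (first-block j)
      reduce _ (first j) = j , trans (∑-blocks _) (∑³-cong (λ u v w →
        cong (Φ (mk u v w)) (flip-block₁ j u v w)))
      reduce _ (second j) = j , trans (∑-blocks _) (trans (∑³-cong (λ u v w →
        trans (cong (Φ (mk u v w)) (flip-block₂ j u v w)) (inv u v w u (flip j v) w)))
        (∑³-rot (first-block j)))
      reduce _ (third j) = j , trans (∑-blocks _) (trans (∑³-cong (λ u v w →
        trans (cong (Φ (mk u v w)) (flip-block₃ j u v w))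
              (trans (inv u v w u v (flip j w)) (inv v w u v (flip j w) u))))
        (∑³-rot² (first-block j)))

-- The invariant carried through the induction.

-- 2ᵐ times the influence of coordinate i on r.
influence : ∀ {m} → (Vec Bool m → Bool) → Fin m → ℕ
influence {m} r i = ∑ m (λ y → ind (r y xor r (flip i y)))

-- 2ᵐ times the expected distance a point is moved by g.
displacement : ∀ {m} → (Vec Bool m → Vec Bool m) → ℕ
displacement {m} g = ∑ m (λ y → dist y (g y))

-- 2ᵐ times the expected distance between the images of i-neighbours.
stretch : ∀ {m} → (Vec Bool m → Vec Bool m) → Fin m → ℕ
stretch {m} g i = ∑ m (λ y → dist (g y) (g (flip i y)))

record GoodRetraction (m : ℕ) (r : Vec Bool m → Bool) : Set where
  field
    g h : Vec Bool m → Vec Bool m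
    g-accepts : ∀ y → r (g y) ≡ true
    g-fixes : ∀ y → r y ≡ true → g y ≡ y
    h-rejects : ∀ y → r y ≡ true → r (h y) ≡ false
    g∘h : ∀ y → r y ≡ true → g (h y) ≡ y
    h∘g : ∀ z → r z ≡ false → h (g z) ≡ z
    half : ℕ
    accepted-count : ∑ m (λ y → ind (r y)) ≡ half
    cube-size : 2 ^ m ≡ half + half
    stretch-bound : ∀ i → stretch g i ≤ 10 * 2 ^ m
    influence×displacement : ∀ i → influence r i * displacement g ≤ 2 ^ m * 2 ^ m

  rejected-count : ∑ m (λ y → ind (not (r y))) ≡ half
  rejected-count = +-cancelˡ-≡ half _ _ (begin
      half + ∑ m (λ y → ind (not (r y)))
    ≡⟨ cong (_+ ∑ m (λ y → ind (not (r y)))) (sym accepted-count) ⟩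
      ∑ m (λ y → ind (r y)) + ∑ m (λ y → ind (not (r y)))
    ≡⟨ accepted+rejected m r ⟩
      2 ^ m
    ≡⟨ cube-size ⟩
      half + half ∎)
    where open ≡-Reasoning

  balanced : ∀ (Φ : Bool → ℕ) → ∑ m (λ y → Φ (r y)) ≡ half * (Φ true + Φ false)
  balanced Φ = begin
      ∑ m (λ y → Φ (r y))
    ≡⟨ ∑-through m r Φ ⟩
      Φ true * ∑ m (λ y → ind (r y)) + Φ false * ∑ m (λ y → ind (not (r y)))
    ≡⟨ cong₂ (λ p q → Φ true * p + Φ false * q) accepted-count rejected-count ⟩
      Φ true * half + Φ false * half
    ≡⟨ sym (*-distribʳ-+ half (Φ true) (Φ false)) ⟩
      (Φ true + Φ false) * half
    ≡⟨ *-comm _ half ⟩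
      half * (Φ true + Φ false) ∎
    where open ≡-Reasoning

GoodRetraction-resp : ∀ {m} {r r′ : Vec Bool m → Bool} → (∀ y → r y ≡ r′ y) →
  GoodRetraction m r → GoodRetraction m r′
GoodRetraction-resp {m} {r} {r′} r≗r′ G = record
  { g = g ; h = h
  ; g-accepts = λ y → trans (sym (r≗r′ (g y))) (g-accepts y)
  ; g-fixes = λ y e → g-fixes y (to-r y e)
  ; h-rejects = λ y e → trans (sym (r≗r′ (h y))) (h-rejects y (to-r y e))
  ; g∘h = λ y e → g∘h y (to-r y e)
  ; h∘g = λ z e → h∘g z (trans (r≗r′ z) e)
  ; half = half
  ; accepted-count = trans (∑-cong m (λ y → cong ind (sym (r≗r′ y)))) accepted-count
  ; cube-size = cube-size
  ; stretch-bound = stretch-bound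
  ; influence×displacement = λ i → subst (λ p → p * displacement g ≤ 2 ^ m * 2 ^ m)
      (∑-cong m (λ y → cong₂ (λ a b → ind (a xor b)) (r≗r′ y) (r≗r′ (flip i y))))
      (influence×displacement i)
  }
  where
    open GoodRetraction G
    to-r : ∀ y → r′ y ≡ true → r y ≡ true
    to-r y e = trans (r≗r′ y) e

-- The two inequalities closing the induction (Q = 2ᵐ, c = Q / 2).

-- New stretch: 1/2 + (old stretch)/2 + influence × displacement ≤ 1/2 + 5 + 1 ≤ 10.
stretch-arith : ∀ Q c s p d → Q ≡ c + c → s ≤ 10 * Q → p * d ≤ Q * Q →
  Q * (Q * c) + (Q * (c * s) + Q * (p * d)) ≤ 10 * (Q * (Q * Q))
stretch-arith _ c s p d refl s≤10Q pd≤QQ = begin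
    Q * (Q * c) + (Q * (c * s) + Q * (p * d))
  ≤⟨ +-monoʳ-≤ (Q * (Q * c)) (+-mono-≤ (*-monoʳ-≤ Q (*-monoʳ-≤ c s≤10Q)) (*-monoʳ-≤ Q pd≤QQ)) ⟩
    Q * (Q * c) + (Q * (c * (10 * Q)) + Q * (Q * Q))
  ≡⟨ expand c ⟩
    52 * (c * (c * c))
  ≤⟨ *-monoˡ-≤ (c * (c * c)) (m≤m+n 52 28) ⟩
    80 * (c * (c * c))
  ≡⟨ sym (target c) ⟩
    10 * (Q * (Q * Q)) ∎
  where
    open ≤-Reasoning
    Q : ℕ
    Q = c + c
    expand : ∀ c → (c + c) * ((c + c) * c) + ((c + c) * (c * (10 * (c + c))) + (c + c) * ((c + c) * (c + c)))
                   ≡ 52 * (c * (c * c))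
    expand = solve-∀
    target : ∀ c → 10 * ((c + c) * ((c + c) * (c + c))) ≡ 80 * (c * (c * c))
    target = solve-∀

-- New influence × displacement: (p/2)·(3d/2) ≤ 3/4 ≤ 1 in normalised units.
influence-arith : ∀ Q c p d → Q ≡ c + c → p * d ≤ Q * Q →
  Q * (p * c) * (Q * (c * d) + (Q * (c * d) + Q * (c * d))) ≤ Q * (Q * Q) * (Q * (Q * Q))
influence-arith _ c p d refl pd≤QQ = begin
    Q * (p * c) * (Q * (c * d) + (Q * (c * d) + Q * (c * d)))
  ≡⟨ factor c p d ⟩
    12 * (c * (c * (c * c))) * (p * d)
  ≤⟨ *-monoʳ-≤ (12 * (c * (c * (c * c)))) pd≤QQ ⟩
    12 * (c * (c * (c * c))) * (Q * Q)
  ≡⟨ expand c ⟩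
    48 * c⁶
  ≤⟨ *-monoˡ-≤ c⁶ (m≤m+n 48 16) ⟩
    64 * c⁶
  ≡⟨ sym (target c) ⟩
    Q * (Q * Q) * (Q * (Q * Q)) ∎
  where
    open ≤-Reasoning
    Q : ℕ
    Q = c + c
    c⁶ : ℕ
    c⁶ = c * (c * (c * (c * (c * c))))
    factor : ∀ c p d → (c + c) * (p * c) * ((c + c) * (c * d) + ((c + c) * (c * d) + (c + c) * (c * d)))
                       ≡ 12 * (c * (c * (c * c))) * (p * d)
    factor = solve-∀
    expand : ∀ c → 12 * (c * (c * (c * c))) * ((c + c) * (c + c)) ≡ 48 * (c * (c * (c * (c * (c * c)))))
    expand = solve-∀
    target : ∀ c → (c + c) * ((c + c) * (c + c)) * ((c + c) * ((c + c) * (c + c)))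
                   ≡ 64 * (c * (c * (c * (c * (c * c)))))
    target = solve-∀

-- The inductive step: from r on m bits to the majority of three copies of r.

module Step {m : ℕ} {r : Vec Bool m → Bool} (G : GoodRetraction m r) where
  open GoodRetraction G
  open Blocks m

  Q : ℕ
  Q = 2 ^ m

  -- Majority of the three block values; for r = recMaj k this is recMaj (suc k).
  R : Vec Bool L → Bool
  R x = maj (r (block₁ x)) (r (block₂ x)) (r (block₃ x))

  R-mk : ∀ u v w → R (mk u v w) ≡ maj (r u) (r v) (r w)
  R-mk u v w = maj-cong (cong r (block₁-mk u v w)) (cong r (block₂-mk u v w)) (cong r (block₃-mk u v w))

  R-rot : ∀ u v w → R (mk u v w) ≡ R (mk v w u)
  R-rot u v w = trans (R-mk u v w) (trans (maj-rot (r u) (r v) (r w)) (sym (R-mk v w u)))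

  repairUnless : Bool → Vec Bool m → Vec Bool m
  repairUnless c y = if c then y else g y

  breakIf : Bool → Vec Bool m → Vec Bool m
  breakIf c y = if c ∧ r y then h y else y

  F H : Vec Bool L → Vec Bool L
  F x = mk (repairUnless (r (block₃ x)) (block₁ x))
           (repairUnless (r (block₁ x)) (block₂ x))
           (repairUnless (r (block₂ x)) (block₃ x))
  H x = mk (breakIf (r (block₂ x)) (block₁ x))
           (breakIf (r (block₃ x)) (block₂ x))
           (breakIf (r (block₁ x)) (block₃ x))

  F-mk : ∀ u v w → F (mk u v w) ≡ mk (repairUnless (r w) u) (repairUnless (r u) v) (repairUnless (r v) w)
  F-mk u v w rewrite block₁-mk u v w | block₂-mk u v w | block₃-mk u v w = refl

  H-mk : ∀ u v w → H (mk u v w) ≡ mk (breakIf (r v) u) (breakIf (r w) v) (breakIf (r u) w)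
  H-mk u v w rewrite block₁-mk u v w | block₂-mk u v w | block₃-mk u v w = refl

  r-repairUnless : ∀ c y → r (repairUnless c y) ≡ (not c ∨ r y)
  r-repairUnless true y = refl
  r-repairUnless false y = g-accepts y

  r-breakIf : ∀ c y → r (breakIf c y) ≡ (r y ∧ not c)
  r-breakIf c y with r y in ry
  r-breakIf true y | true = h-rejects y ry
  r-breakIf false y | true = ry
  r-breakIf true y | false = ry
  r-breakIf false y | false = ry

  repairUnless-keeps : ∀ c y → (c ∨ r y) ≡ true → repairUnless c y ≡ y
  repairUnless-keeps true y _ = refl
  repairUnless-keeps false y accepted = g-fixes y accepted

  breakIf-keeps : ∀ b y → r y ≡ false → breakIf b y ≡ y
  breakIf-keeps true y rejected rewrite rejected = refl
  breakIf-keeps false y rejected = refl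

  breakIf-breaks : ∀ y → r y ≡ true → breakIf true y ≡ h y
  breakIf-breaks y accepted rewrite accepted = refl

  repair∘break : ∀ y b c → maj (r y) b c ≡ true → repairUnless (c ∧ not (r y)) (breakIf b y) ≡ y
  repair∘break y b c e with r y in ry
  repair∘break y true true e | true = g∘h y ry
  repair∘break y true false e | true = g∘h y ry
  repair∘break y false true e | true = g-fixes y ry
  repair∘break y false false e | true = g-fixes y ry
  repair∘break y true true e | false = refl
  repair∘break y false true () | false
  repair∘break y true false () | false
  repair∘break y false false () | false

  break∘repair : ∀ y b c → maj (r y) b c ≡ false → breakIf (not (r y) ∨ b) (repairUnless c y) ≡ y
  break∘repair y b c e with r y in ry
  break∘repair y b false e | false = trans (breakIf-breaks (g y) (g-accepts y)) (h∘g y ry)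
  break∘repair y b true e | false = breakIf-keeps true y ry
  break∘repair y false false e | true = g-fixes y ry
  break∘repair y true c () | true
  break∘repair y false true () | true

  F-accepts : ∀ x → R (F x) ≡ true
  F-accepts x = begin
      R (F x)
    ≡⟨ R-mk _ _ _ ⟩
      maj (r (repairUnless (r w) u)) (r (repairUnless (r u) v)) (r (repairUnless (r v) w))
    ≡⟨ maj-cong (r-repairUnless (r w) u) (r-repairUnless (r u) v) (r-repairUnless (r v) w) ⟩
      maj (not (r w) ∨ r u) (not (r u) ∨ r v) (not (r v) ∨ r w)
    ≡⟨ maj-repaired (r u) (r v) (r w) ⟩
      true ∎
    where
      open ≡-Reasoning
      u v w : Vec Bool m
      u = block₁ x
      v = block₂ x
      w = block₃ x

  F-fixes : ∀ x → R x ≡ true → F x ≡ x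
  F-fixes x accepted = trans
    (mk-cong (repairUnless-keeps (r w) u (maj-predecessor (r u) (r v) (r w) accepted))
             (repairUnless-keeps (r u) v (maj-predecessor (r v) (r w) (r u) accepted′))
             (repairUnless-keeps (r v) w (maj-predecessor (r w) (r u) (r v) (rotate-maj (r v) (r w) (r u) accepted′))))
    (mk-blocks x)
    where
      u v w : Vec Bool m
      u = block₁ x
      v = block₂ x
      w = block₃ x
      accepted′ : maj (r v) (r w) (r u) ≡ true
      accepted′ = rotate-maj (r u) (r v) (r w) accepted

  H-rejects : ∀ x → R x ≡ true → R (H x) ≡ false
  H-rejects x accepted = begin
      R (H x)
    ≡⟨ R-mk _ _ _ ⟩
      maj (r (breakIf (r v) u)) (r (breakIf (r w) v)) (r (breakIf (r u) w))
    ≡⟨ maj-cong (r-breakIf (r v) u) (r-breakIf (r w) v) (r-breakIf (r u) w) ⟩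
      maj (r u ∧ not (r v)) (r v ∧ not (r w)) (r w ∧ not (r u))
    ≡⟨ maj-broken (r u) (r v) (r w) accepted ⟩
      false ∎
    where
      open ≡-Reasoning
      u v w : Vec Bool m
      u = block₁ x
      v = block₂ x
      w = block₃ x

  -- In the two inverse laws, p is the predecessor and s the successor of block y.
  F∘H : ∀ x → R x ≡ true → F (H x) ≡ x
  F∘H x accepted = trans (F-mk _ _ _)
    (trans (mk-cong (restore u v w accepted) (restore v w u accepted′) (restore w u v (rotate-maj (r v) (r w) (r u) accepted′)))
           (mk-blocks x))
    where
      u v w : Vec Bool m
      u = block₁ x
      v = block₂ x
      w = block₃ x
      accepted′ : maj (r v) (r w) (r u) ≡ true
      accepted′ = rotate-maj (r u) (r v) (r w) accepted
      restore : ∀ y s p → maj (r y) (r s) (r p) ≡ true →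
        repairUnless (r (breakIf (r y) p)) (breakIf (r s) y) ≡ y
      restore y s p e =
        trans (cong (λ t → repairUnless t (breakIf (r s) y)) (r-breakIf (r y) p)) (repair∘break y (r s) (r p) e)

  H∘F : ∀ x → R x ≡ false → H (F x) ≡ x
  H∘F x rejected = trans (H-mk _ _ _)
    (trans (mk-cong (restore u v w rejected) (restore v w u rejected′) (restore w u v (rotate-maj (r v) (r w) (r u) rejected′)))
           (mk-blocks x))
    where
      u v w : Vec Bool m
      u = block₁ x
      v = block₂ x
      w = block₃ x
      rejected′ : maj (r v) (r w) (r u) ≡ false
      rejected′ = rotate-maj (r u) (r v) (r w) rejected
      restore : ∀ y s p → maj (r y) (r s) (r p) ≡ false →
        breakIf (r (repairUnless (r y) s)) (repairUnless (r p) y) ≡ y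
      restore y s p e =
        trans (cong (λ t → breakIf t (repairUnless (r p) y)) (r-repairUnless (r y) s)) (break∘repair y (r s) (r p) e)

  balanced³ : ∀ (Φ : Bool → Bool → Bool → ℕ) → ∑³ (λ u v w → Φ (r u) (r v) (r w)) ≡
    half * (half * (half * (Φ true true true + Φ true true false) + half * (Φ true false true + Φ true false false))
          + half * (half * (Φ false true true + Φ false true false) + half * (Φ false false true + Φ false false false)))
  balanced³ Φ = trans (∑-cong m (λ u → trans (∑-cong m (λ v → balanced (Φ (r u) (r v))))
                                             (balanced (λ b → half * (Φ (r u) b true + Φ (r u) b false)))))
                      (balanced (λ a → half * (half * (Φ a true true + Φ a true false)
                                              + half * (Φ a false true + Φ a false false))))

  accepted-count′ : ∑ L (λ x → ind (R x)) ≡ 4 * (half * (half * half))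
  accepted-count′ = begin
      ∑ L (λ x → ind (R x))
    ≡⟨ ∑-blocks _ ⟩
      ∑³ (λ u v w → ind (R (mk u v w)))
    ≡⟨ ∑³-cong (λ u v w → cong ind (R-mk u v w)) ⟩
      ∑³ (λ u v w → ind (maj (r u) (r v) (r w)))
    ≡⟨ balanced³ (λ a b c → ind (maj a b c)) ⟩
      half * (half * (half * 2 + half * 1) + half * (half * 1 + half * 0))
    ≡⟨ count half ⟩
      4 * (half * (half * half)) ∎
    where
      open ≡-Reasoning
      count : ∀ c → c * (c * (c * 2 + c * 1) + c * (c * 1 + c * 0)) ≡ 4 * (c * (c * c))
      count = solve-∀

  cube-L : 2 ^ L ≡ Q * (Q * Q)
  cube-L = trans (^-distribˡ-+-* 2 m _) (cong (Q *_)
    (trans (^-distribˡ-+-* 2 m _) (cong (Q *_) (cong (2 ^_) (+-identityʳ m)))))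

  cube-size′ : 2 ^ L ≡ 4 * (half * (half * half)) + 4 * (half * (half * half))
  cube-size′ = trans cube-L (trans (cong (λ t → t * (t * t)) cube-size) (count half))
    where
      count : ∀ c → (c + c) * ((c + c) * (c + c)) ≡ 4 * (c * (c * c)) + 4 * (c * (c * c))
      count = solve-∀

  repair-cost : ∀ c y → dist y (repairUnless c y) ≡ ind (not c) * dist y (g y)
  repair-cost true y = dist-refl y
  repair-cost false y = sym (+-identityʳ _)

  repair-stretch : ∀ c j y → dist (repairUnless c y) (repairUnless c (flip j y)) ≡
    ind c + ind (not c) * dist (g y) (g (flip j y))
  repair-stretch true j y = dist-flip j y
  repair-stretch false j y = sym (+-identityʳ _)

  repair-switch : ∀ a a′ y → dist (repairUnless a y) (repairUnless a′ y) ≡ ind (a xor a′) * dist y (g y)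
  repair-switch true true y = dist-refl y
  repair-switch true false y = sym (+-identityʳ _)
  repair-switch false true y = trans (dist-sym (g y) y) (sym (+-identityʳ _))
  repair-switch false false y = dist-refl (g y)

  ∑³-rejected-predecessor : ∀ φ → ∑³ (λ u v w → ind (not (r w)) * φ u) ≡ Q * (half * ∑ m φ)
  ∑³-rejected-predecessor φ = begin
      ∑ m (λ u → ∑ m (λ v → ∑ m (λ w → ind (not (r w)) * φ u)))
    ≡⟨ ∑-cong m (λ u → ∑-cong m (λ v → trans (∑-*ʳ m (φ u) _) (cong (_* φ u) rejected-count))) ⟩
      ∑ m (λ u → ∑ m (λ v → half * φ u))
    ≡⟨ ∑-cong m (λ u → ∑-const m _) ⟩
      ∑ m (λ u → Q * (half * φ u))
    ≡⟨ trans (∑-*ˡ m Q _) (cong (Q *_) (∑-*ˡ m half φ)) ⟩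
      Q * (half * ∑ m φ) ∎
    where open ≡-Reasoning

  -- Each block is repaired, at cost dist y (g y), when its predecessor rejects.
  displacement′ : displacement F ≡ Q * (half * displacement g) + (Q * (half * displacement g) + Q * (half * displacement g))
  displacement′ = begin
      ∑ L (λ x → dist x (F x))
    ≡⟨ ∑-blocks _ ⟩
      ∑³ (λ u v w → dist (mk u v w) (F (mk u v w)))
    ≡⟨ ∑³-cong (λ u v w → trans (cong (dist (mk u v w)) (F-mk u v w))
                                (dist-mk u v w (repairUnless (r w) u) (repairUnless (r u) v) (repairUnless (r v) w))) ⟩
      ∑³ (λ u v w → cost u v w + (cost v w u + cost w u v))
    ≡⟨ trans (∑³-+ _ _) (cong (∑³ cost +_) (trans (∑³-+ _ _) (cong₂ _+_ (∑³-rot cost) (∑³-rot² cost)))) ⟩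
      ∑³ cost + (∑³ cost + ∑³ cost)
    ≡⟨ cong (λ t → t + (t + t)) (trans (∑³-cong (λ u v w → repair-cost (r w) u)) (∑³-rejected-predecessor _)) ⟩
      Q * (half * displacement g) + (Q * (half * displacement g) + Q * (half * displacement g)) ∎
    where
      open ≡-Reasoning
      cost : Vec Bool m → Vec Bool m → Vec Bool m → ℕ
      cost u v w = dist u (repairUnless (r w) u)

  influence-first : ∀ j → ∑³ (λ u v w → ind (R (mk u v w) xor R (mk (flip j u) v w))) ≡ Q * (influence r j * half)
  influence-first j = begin
      ∑³ (λ u v w → ind (R (mk u v w) xor R (mk (flip j u) v w)))
    ≡⟨ ∑³-cong (λ u v w → trans (cong₂ (λ a b → ind (a xor b)) (R-mk u v w) (R-mk _ v w))
                                (maj-pivotal (r u) (r (flip j u)) (r v) (r w))) ⟩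
      ∑³ (λ u v w → pivotal u * ind (r v xor r w))
    ≡⟨ ∑-cong m (λ u → ∑-cong m (λ v → trans (∑-*ˡ m (pivotal u) _) (cong (pivotal u *_) (disagree v)))) ⟩
      ∑ m (λ u → ∑ m (λ v → pivotal u * half))
    ≡⟨ ∑-cong m (λ u → ∑-const m _) ⟩
      ∑ m (λ u → Q * (pivotal u * half))
    ≡⟨ trans (∑-*ˡ m Q _) (cong (Q *_) (∑-*ʳ m half pivotal)) ⟩
      Q * (influence r j * half) ∎
    where
      open ≡-Reasoning
      pivotal : Vec Bool m → ℕ
      pivotal u = ind (r u xor r (flip j u))
      either : ∀ t → ind (t xor true) + ind (t xor false) ≡ 1
      either true = refl
      either false = refl
      disagree : ∀ v → ∑ m (λ w → ind (r v xor r w)) ≡ half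
      disagree v = trans (balanced (λ t → ind (r v xor t))) (trans (cong (half *_) (either (r v))) (*-identityʳ half))

  stretch-first : ∀ j → ∑³ (λ u v w → dist (F (mk u v w)) (F (mk (flip j u) v w))) ≡
    Q * (Q * half) + (Q * (half * stretch g j) + Q * (influence r j * displacement g))
  stretch-first j = begin
      ∑³ (λ u v w → dist (F (mk u v w)) (F (mk (flip j u) v w)))
    ≡⟨ ∑³-cong pointwise ⟩
      ∑³ (λ u v w → ind (r w) + (ind (not (r w)) * stretch₁ u + pivotal u * dist v (g v)))
    ≡⟨ trans (∑³-+ _ _) (cong (∑³ (λ u v w → ind (r w)) +_) (∑³-+ _ _)) ⟩
      ∑³ (λ u v w → ind (r w)) + (∑³ (λ u v w → ind (not (r w)) * stretch₁ u) + ∑³ (λ u v w → pivotal u * dist v (g v)))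
    ≡⟨ cong₂ _+_ accepted-predecessor (cong₂ _+_ (∑³-rejected-predecessor stretch₁) pivotal-moves) ⟩
      Q * (Q * half) + (Q * (half * stretch g j) + Q * (influence r j * displacement g)) ∎
    where
      open ≡-Reasoning
      stretch₁ : Vec Bool m → ℕ
      stretch₁ u = dist (g u) (g (flip j u))
      pivotal : Vec Bool m → ℕ
      pivotal u = ind (r u xor r (flip j u))
      -- Block u moves by one or by its stretch under g; block v moves iff r u changed.
      pointwise : ∀ u v w → dist (F (mk u v w)) (F (mk (flip j u) v w)) ≡
        ind (r w) + (ind (not (r w)) * stretch₁ u + pivotal u * dist v (g v))
      pointwise u v w = begin
          dist (F (mk u v w)) (F (mk u′ v w))
        ≡⟨ cong₂ dist (F-mk u v w) (F-mk u′ v w) ⟩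
          dist (mk (repairUnless (r w) u) (repairUnless (r u) v) (repairUnless (r v) w))
               (mk (repairUnless (r w) u′) (repairUnless (r u′) v) (repairUnless (r v) w))
        ≡⟨ dist-mk (repairUnless (r w) u) (repairUnless (r u) v) (repairUnless (r v) w)
                   (repairUnless (r w) u′) (repairUnless (r u′) v) (repairUnless (r v) w) ⟩
          dist (repairUnless (r w) u) (repairUnless (r w) u′)
            + (dist (repairUnless (r u) v) (repairUnless (r u′) v) + dist (repairUnless (r v) w) (repairUnless (r v) w))
        ≡⟨ cong₂ _+_ (repair-stretch (r w) j u) (cong₂ _+_ (repair-switch (r u) (r u′) v) (dist-refl (repairUnless (r v) w))) ⟩
          (ind (r w) + ind (not (r w)) * stretch₁ u) + (pivotal u * dist v (g v) + 0)
        ≡⟨ trans (+-assoc (ind (r w)) _ _) (cong (λ t → ind (r w) + (ind (not (r w)) * stretch₁ u + t)) (+-identityʳ _)) ⟩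
          ind (r w) + (ind (not (r w)) * stretch₁ u + pivotal u * dist v (g v)) ∎
        where
          u′ : Vec Bool m
          u′ = flip j u
      accepted-predecessor : ∑³ (λ u v w → ind (r w)) ≡ Q * (Q * half)
      accepted-predecessor = trans (∑-cong m (λ u → trans (∑-cong m (λ v → accepted-count)) (∑-const m half)))
                                   (∑-const m _)
      pivotal-moves : ∑³ (λ u v w → pivotal u * dist v (g v)) ≡ Q * (influence r j * displacement g)
      pivotal-moves = begin
          ∑ m (λ u → ∑ m (λ v → ∑ m (λ w → pivotal u * dist v (g v))))
        ≡⟨ ∑-cong m (λ u → trans (∑-cong m (λ v → ∑-const m _)) (trans (∑-*ˡ m Q _) (cong (Q *_) (∑-*ˡ m (pivotal u) _)))) ⟩
          ∑ m (λ u → Q * (pivotal u * displacement g))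
        ≡⟨ trans (∑-*ˡ m Q _) (cong (Q *_) (∑-*ʳ m _ pivotal)) ⟩
          Q * (influence r j * displacement g) ∎

  F-rotation : RotationInvariant (λ x x′ → dist (F x) (F x′))
  F-rotation u v w u′ v′ w′ = begin
      dist (F (mk u v w)) (F (mk u′ v′ w′))
    ≡⟨ cong₂ dist (F-mk u v w) (F-mk u′ v′ w′) ⟩
      dist (mk (repairUnless (r w) u) (repairUnless (r u) v) (repairUnless (r v) w))
           (mk (repairUnless (r w′) u′) (repairUnless (r u′) v′) (repairUnless (r v′) w′))
    ≡⟨ dist-mk-rot (repairUnless (r w) u) (repairUnless (r u) v) (repairUnless (r v) w)
                   (repairUnless (r w′) u′) (repairUnless (r u′) v′) (repairUnless (r v′) w′) ⟩
      dist (mk (repairUnless (r u) v) (repairUnless (r v) w) (repairUnless (r w) u))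
           (mk (repairUnless (r u′) v′) (repairUnless (r v′) w′) (repairUnless (r w′) u′))
    ≡⟨ sym (cong₂ dist (F-mk v w u) (F-mk v′ w′ u′)) ⟩
      dist (F (mk v w u)) (F (mk v′ w′ u′)) ∎
    where open ≡-Reasoning

  R-rotation : RotationInvariant (λ x x′ → ind (R x xor R x′))
  R-rotation u v w u′ v′ w′ = cong₂ (λ a b → ind (a xor b)) (R-rot u v w) (R-rot u′ v′ w′)

  stretch-bound′ : ∀ i → stretch F i ≤ 10 * 2 ^ L
  stretch-bound′ i with flip-any-block (λ x x′ → dist (F x) (F x′)) F-rotation i
  ... | j , to-first = begin
      stretch F i
    ≡⟨ trans to-first (stretch-first j) ⟩
      Q * (Q * half) + (Q * (half * stretch g j) + Q * (influence r j * displacement g))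
    ≤⟨ stretch-arith Q half (stretch g j) (influence r j) (displacement g) cube-size (stretch-bound j) (influence×displacement j) ⟩
      10 * (Q * (Q * Q))
    ≡⟨ cong (10 *_) (sym cube-L) ⟩
      10 * 2 ^ L ∎
    where open ≤-Reasoning

  influence×displacement′ : ∀ i → influence R i * displacement F ≤ 2 ^ L * 2 ^ L
  influence×displacement′ i with flip-any-block (λ x x′ → ind (R x xor R x′)) R-rotation i
  ... | j , to-first = begin
      influence R i * displacement F
    ≡⟨ cong₂ _*_ (trans to-first (influence-first j)) displacement′ ⟩
      Q * (influence r j * half) * (X + (X + X))
    ≤⟨ influence-arith Q half (influence r j) (displacement g) cube-size (influence×displacement j) ⟩
      Q * (Q * Q) * (Q * (Q * Q))
    ≡⟨ cong₂ _*_ (sym cube-L) (sym cube-L) ⟩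
      2 ^ L * 2 ^ L ∎
    where
      open ≤-Reasoning
      X : ℕ
      X = Q * (half * displacement g)

  next : GoodRetraction L R
  next = record
    { g = F ; h = H
    ; g-accepts = F-accepts ; g-fixes = F-fixes ; h-rejects = H-rejects ; g∘h = F∘H ; h∘g = H∘F
    ; half = 4 * (half * (half * half))
    ; accepted-count = accepted-count′
    ; cube-size = cube-size′
    ; stretch-bound = stretch-bound′
    ; influence×displacement = influence×displacement′
    }

bit : Vec Bool 1 → Bool
bit (a ∷ []) = a

all-one all-zero : Vec Bool 1 → Vec Bool 1
all-one _ = true ∷ []
all-zero _ = false ∷ []

all-one-fixes : ∀ y → bit y ≡ true → all-one y ≡ y
all-one-fixes (true ∷ []) _ = refl

all-one∘all-zero : ∀ y → bit y ≡ true → all-one (all-zero y) ≡ y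
all-one∘all-zero (true ∷ []) _ = refl

all-zero∘all-one : ∀ y → bit y ≡ false → all-zero (all-one y) ≡ y
all-zero∘all-one (false ∷ []) _ = refl

-- Stretch 0, and influence × displacement = 2 · 1 ≤ 2 · 2.
dictator : GoodRetraction 1 bit
dictator = record
  { g = all-one ; h = all-zero
  ; g-accepts = λ _ → refl ; g-fixes = all-one-fixes ; h-rejects = λ _ _ → refl
  ; g∘h = all-one∘all-zero ; h∘g = all-zero∘all-one
  ; half = 1 ; accepted-count = refl ; cube-size = refl
  ; stretch-bound = λ { zero → z≤n }
  ; influence×displacement = λ { zero → s≤s (s≤s z≤n) }
  }

recMaj-base : ∀ x → Step.R dictator x ≡ recMaj zero x
recMaj-base (a ∷ b ∷ c ∷ []) = refl

good : (k : ℕ) → GoodRetraction (3 ^ suc k) (recMaj k)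
good zero = GoodRetraction-resp recMaj-base (Step.next dictator)
good (suc k) = Step.next (good k)

lemma1 : (k : ℕ) →
    Σ (Vec Bool (3 ^ suc k) → Vec Bool (3 ^ suc k)) λ f →
      ((x : Vec Bool (3 ^ suc k)) → recMaj k (f x) ≡ true) ×
      ((x : Vec Bool (3 ^ suc k)) → recMaj k x ≡ true → f x ≡ x) ×
      ((x : Vec Bool (3 ^ suc k)) → recMaj k x ≡ true →
        ∃ λ z → recMaj k z ≡ false × f z ≡ x ×
          ((z′ : Vec Bool (3 ^ suc k)) → recMaj k z′ ≡ false → f z′ ≡ x → z′ ≡ z)) ×
      ((i : Fin (3 ^ suc k)) →
        sum (map (λ x → dist (f x) (f (flip i x))) (allVecs (3 ^ suc k)))
          ≤ 10 * 2 ^ (3 ^ suc k))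
lemma1 k = g , g-accepts , g-fixes , preimage , bounded-stretch
  where
    open GoodRetraction (good k)
    -- The unique rejected preimage of an accepted x is h x, since h inverts g on rejected points.
    preimage : ∀ x → recMaj k x ≡ true →
      ∃ λ z → recMaj k z ≡ false × g z ≡ x × (∀ z′ → recMaj k z′ ≡ false → g z′ ≡ x → z′ ≡ z)
    preimage x accepted = h x , h-rejects x accepted , g∘h x accepted ,
      λ z′ rejected g-z′≡x → trans (sym (h∘g z′ rejected)) (cong h g-z′≡x)
    bounded-stretch : ∀ i → sum (map (λ x → dist (g x) (g (flip i x))) (allVecs (3 ^ suc k))) ≤ 10 * 2 ^ (3 ^ suc k)
    bounded-stretch i = subst (_≤ 10 * 2 ^ (3 ^ suc k)) (sym (sum-allVecs _ (λ x → dist (g x) (g (flip i x))))) (stretch-bound i)
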